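{- Let $P$ be a finite poset. A connected nonprincipal order ideal $J$ of $P$ is nearly principal if and only if (a) $J$ has exactly two maximal elements $j_1,j_2$, and (b) for every common lower bound $\ell<_P j_1,j_2$, the open intervals $]\ell,j_1[$ and $]\ell,j_2[$ coincide.
   Context: An order ideal is connected if its induced Hasse diagram is connected. Two order ideals intersect nontrivially if they are neither disjoint nor nested. A connected nonprincipal order ideal $J$ is nearly principal if there is exactly one unordered pair $\{J_1,J_2\}$ of nonempty connected order ideals intersecting nontrivially with $J_1\cup J_2=J$. $]\ell,j[=\{p\in P:\ell<_P p<_P j\}$. -}

module Defs where

open import Data.Nat using (ℕ)
open import Data.Fin using (Fin)
open import Data.Fin.Subset using (Subset; _∈_; _∉_; _⊆_; _∩_; _∪_; Nonempty)
open import Data.Product using (Σ; ∃; ∃-syntax; _×_; _,_)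
open import Data.Sum using (_⊎_)
open import Data.Empty using (⊥)
open import Relation.Nullary using (¬_)
open import Relation.Binary using (Rel; Decidable; IsPartialOrder)
open import Relation.Binary.PropositionalEquality using (_≡_; _≢_)
open import Function.Bundles using (_⇔_)
open import Level using (0ℓ)

record FinPoset : Set₁ where
  field
    n              : ℕ
    _≤_            : Rel (Fin n) 0ℓ
    isPartialOrder : IsPartialOrder _≡_ _≤_
    _≤?_           : Decidable _≤_

module _ (P : FinPoset) where
  open FinPoset P

  _<_ : Rel (Fin n) 0ℓ
  x < y = (x ≤ y) × (x ≢ y)

  _⋖_ : Rel (Fin n) 0ℓ
  x ⋖ y = (x < y) × (∀ z → ¬ ((x < z) × (z < y)))

  IsOrderIdeal : Subset n → Set
  IsOrderIdeal J = ∀ x y → y ≤ x → x ∈ J → y ∈ J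

  data HassePath (J : Subset n) : Fin n → Fin n → Set where
    here : ∀ {x} → x ∈ J → HassePath J x x
    up   : ∀ {x y z} → x ∈ J → x ⋖ y → HassePath J y z → HassePath J x z
    down : ∀ {x y z} → x ∈ J → y ⋖ x → HassePath J y z → HassePath J x z

  IsConnected : Subset n → Set
  IsConnected J = ∀ x y → x ∈ J → y ∈ J → HassePath J x y

  IsPrincipal : Subset n → Set
  IsPrincipal J = ∃[ x ] (∀ y → (y ∈ J) ⇔ (y ≤ x))

  IntersectNontrivially : Subset n → Subset n → Set
  IntersectNontrivially J₁ J₂ =
    Nonempty (J₁ ∩ J₂) × ¬ (J₁ ⊆ J₂) × ¬ (J₂ ⊆ J₁)

  IsSplitting : Subset n → Subset n → Subset n → Set
  IsSplitting J J₁ J₂ =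
    Nonempty J₁ × IsOrderIdeal J₁ × IsConnected J₁ ×
    Nonempty J₂ × IsOrderIdeal J₂ × IsConnected J₂ ×
    IntersectNontrivially J₁ J₂ × (J₁ ∪ J₂ ≡ J)

  -- exactly one unordered pair {J₁, J₂} splits J
  IsNearlyPrincipal : Subset n → Set
  IsNearlyPrincipal J =
    IsOrderIdeal J × IsConnected J × ¬ IsPrincipal J ×
    ∃[ J₁ ] ∃[ J₂ ] (IsSplitting J J₁ J₂ ×
      (∀ K₁ K₂ → IsSplitting J K₁ K₂ →
         ((K₁ ≡ J₁) × (K₂ ≡ J₂)) ⊎ ((K₁ ≡ J₂) × (K₂ ≡ J₁))))

  IsMaximalIn : Subset n → Fin n → Set
  IsMaximalIn J x = x ∈ J × (∀ y → y ∈ J → ¬ (x < y))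

  OpenInterval : Fin n → Fin n → Fin n → Set
  OpenInterval ℓ j p = (ℓ < p) × (p < j)

-- The whole argument revolves around principal ideals ↓ x and one
-- path-lemma: a Hasse path leaving a down-closed set does so along an upward
-- cover (upward-exit).
--
-- (⇒) Let {A, B} be the unique splitting.  The growth lemma says that for
-- x ∈ A ∖ B with ↓ x meeting B we have A ⊆ ↓ x ∪ B, since otherwise
-- {A, B ∪ ↓ x} would be a second splitting.  Leaving B inside A and going up
-- to a maximal element x of J, the growth lemma makes {↓ x, B} a splitting,
-- so A = ↓ x; symmetrically B = ↓ y.  Condition (b) follows from the growth
-- lemma applied to a point p ∈ ]ℓ, x[.
-- (⇐) Under (a), J = ↓ j₁ ∪ ↓ j₂ and {↓ j₁, ↓ j₂} is a splitting.  Given any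
-- splitting, the part containing j₁ misses j₂, and by (b) a connected ideal
-- containing j₁ but not j₂ cannot leave ↓ j₁, so the splitting is {↓ j₁, ↓ j₂}.
module Submission where

open import Defs
open import Data.Fin using (Fin)
open import Data.Fin.Subset using (Subset)
open import Data.Product using (∃-syntax; _×_)
open import Data.Sum using (_⊎_)
open import Relation.Nullary using (¬_)
open import Relation.Binary.PropositionalEquality using (_≡_; _≢_)
open import Function.Bundles using (_⇔_)

open import Data.Bool using (true)
open import Data.Empty using (⊥-elim)
open import Data.Nat using (ℕ)
open import Data.Fin.Properties using (any?) renaming (_≟_ to _≟ᶠ_)
open import Data.Fin.Induction using (po-wellFounded; po-noetherian)
open import Data.Fin.Subset using (_∈_; _∉_; _⊆_; _∩_; _∪_; Nonempty)
open import Data.Fin.Subset.Properties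
  using (_∈?_; _⊆?_; ⊆-antisym; ⊆-reflexive; p⊆p∪q; q⊆p∪q; x∈p∪q⁺; x∈p∪q⁻; x∈p∩q⁺; x∈p∩q⁻; ∪-comm)
open import Data.Product using (_,_; proj₁; proj₂) renaming (swap to swap-×)
open import Data.Sum using (inj₁; inj₂; [_,_]′) renaming (swap to swap-⊎; map to map-⊎)
open import Data.Vec using (tabulate)
open import Data.Vec.Properties using (lookup∘tabulate; lookup⇒[]=; []=⇒lookup)
open import Function.Bundles using (mk⇔; Equivalence)
open import Function.Properties.Equivalence using () renaming (sym to ⇔-sym)
open import Induction.WellFounded using (Acc; acc)
open import Relation.Binary using (IsPartialOrder)
open import Relation.Binary.PropositionalEquality using (refl; sym; trans; subst)
open import Relation.Nullary using (Dec; yes; no; does; proof)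
open import Relation.Nullary.Decidable using (_×-dec_; ¬?; dec-true; decidable-stable)
open import Relation.Nullary.Reflects using (Reflects; invert)

module _ {n : ℕ} where

  witness-outside : ∀ {A B : Subset n} → ¬ (A ⊆ B) → ∃[ w ] (w ∈ A × w ∉ B)
  witness-outside {A} {B} A⊈B with any? (λ w → (w ∈? A) ×-dec ¬? (w ∈? B))
  ... | yes found = found
  ... | no none = ⊥-elim (A⊈B (λ {w} w∈A → decidable-stable (w ∈? B) (λ w∉B → none (w , w∈A , w∉B))))

  ∪-⊆ : ∀ {A B C : Subset n} → A ⊆ C → B ⊆ C → A ∪ B ⊆ C
  ∪-⊆ {A} {B} A⊆C B⊆C x∈A∪B = [ A⊆C , B⊆C ]′ (x∈p∪q⁻ A B x∈A∪B)

  union-equals : ∀ {A B C : Subset n} → A ⊆ C → B ⊆ C → C ⊆ A ∪ B → A ∪ B ≡ C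
  union-equals A⊆C B⊆C C⊆A∪B = ⊆-antisym (∪-⊆ A⊆C B⊆C) C⊆A∪B

  module UnionEquation {A B C : Subset n} (A∪B≡C : A ∪ B ≡ C) where
    left⊆ : A ⊆ C
    left⊆ x∈A = subst (_ ∈_) A∪B≡C (p⊆p∪q B x∈A)

    right⊆ : B ⊆ C
    right⊆ x∈B = subst (_ ∈_) A∪B≡C (q⊆p∪q A B x∈B)

    either : ∀ {x} → x ∈ C → x ∈ A ⊎ x ∈ B
    either x∈C = x∈p∪q⁻ A B (subst (_ ∈_) (sym A∪B≡C) x∈C)

module PosetFacts (P : FinPoset) where
  open FinPoset P
  open IsPartialOrder isPartialOrder using () renaming (refl to ≤-refl; trans to ≤-trans)

  _≺_ : Fin n → Fin n → Set
  x ≺ y = _<_ P x y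

  _<?_ : ∀ x y → Dec (x ≺ y)
  x <? y = (x ≤? y) ×-dec ¬? (x ≟ᶠ y)

  accessible : (x : Fin n) → Acc _≺_ x
  accessible = po-wellFounded isPartialOrder

  co-accessible : (x : Fin n) → Acc (λ a b → b ≺ a) x
  co-accessible = po-noetherian isPartialOrder

  ↓ : Fin n → Subset n
  ↓ j = tabulate (λ y → does (y ≤? j))

  ↓⁺ : ∀ {y j} → y ≤ j → y ∈ ↓ j
  ↓⁺ {y} {j} y≤j =
    lookup⇒[]= y (↓ j) (trans (lookup∘tabulate _ y) (dec-true (y ≤? j) y≤j))

  ↓⁻ : ∀ {y j} → y ∈ ↓ j → y ≤ j
  ↓⁻ {y} {j} y∈↓j = invert (subst (Reflects (y ≤ j)) does≡true (proof (y ≤? j)))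
    where
    does≡true : does (y ≤? j) ≡ true
    does≡true = trans (sym (lookup∘tabulate (λ z → does (z ≤? j)) y)) ([]=⇒lookup y∈↓j)

  j∈↓j : ∀ {j} → j ∈ ↓ j
  j∈↓j = ↓⁺ ≤-refl

  ↓-least : ∀ {I x} → IsOrderIdeal P I → x ∈ I → ↓ x ⊆ I
  ↓-least {x = x} I-ideal x∈I y∈↓x = I-ideal x _ (↓⁻ y∈↓x) x∈I

  ↓-ideal : ∀ j → IsOrderIdeal P (↓ j)
  ↓-ideal j x y y≤x x∈↓j = ↓⁺ (≤-trans y≤x (↓⁻ x∈↓j))

  ∪-ideal : ∀ {A B} → IsOrderIdeal P A → IsOrderIdeal P B → IsOrderIdeal P (A ∪ B)
  ∪-ideal {A} {B} A-ideal B-ideal x y y≤x x∈A∪B with x∈p∪q⁻ A B x∈A∪B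
  ... | inj₁ x∈A = x∈p∪q⁺ (inj₁ (A-ideal x y y≤x x∈A))
  ... | inj₂ x∈B = x∈p∪q⁺ (inj₂ (B-ideal x y y≤x x∈B))

  record MaximalAbove (K : Subset n) (x : Fin n) : Set where
    field
      top         : Fin n
      top-maximal : IsMaximalIn P K top
      below-top   : x ≤ top

  maximal-above : ∀ {K x} → x ∈ K → MaximalAbove K x
  maximal-above {K} {x} = go x (co-accessible x)
    where
    go : ∀ y → Acc (λ a b → b ≺ a) y → y ∈ K → MaximalAbove K y
    go y (acc rs) y∈K with any? (λ z → (z ∈? K) ×-dec (y <? z))
    ... | yes (z , z∈K , y≺z) =
      let open MaximalAbove (go z (rs y≺z) z∈K)
      in record { top = top ; top-maximal = top-maximal ; below-top = ≤-trans (proj₁ y≺z) below-top }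
    ... | no nothing-above = record
      { top = y
      ; top-maximal = y∈K , λ z z∈K y≺z → nothing-above (z , z∈K , y≺z)
      ; below-top = ≤-refl }

  maximal-≤ : ∀ {K x y} → IsMaximalIn P K y → x ∈ K → y ≤ x → y ≡ x
  maximal-≤ {x = x} {y} (_ , y-max) x∈K y≤x =
    decidable-stable (y ≟ᶠ x) (λ y≢x → y-max x x∈K (y≤x , y≢x))

  maximal-≰ : ∀ {K x y} → IsMaximalIn P K y → x ∈ K → y ≢ x → ¬ (y ≤ x)
  maximal-≰ y-maximal x∈K y≢x y≤x = y≢x (maximal-≤ y-maximal x∈K y≤x)

  cover-below : ∀ {x w} → x ≺ w → ∃[ y ] (_⋖_ P x y × y ≤ w)
  cover-below {x} {w} = go w (accessible w)
    where
    go : ∀ v → Acc _≺_ v → x ≺ v → ∃[ y ] (_⋖_ P x y × y ≤ v)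
    go v (acc rs) x≺v with any? (λ z → (x <? z) ×-dec (z <? v))
    ... | yes (z , x≺z , z≺v) with go z (rs z≺v) x≺z
    ...   | y , x⋖y , y≤z = y , x⋖y , ≤-trans y≤z (proj₁ z≺v)
    go v (acc rs) x≺v | no nothing-between = v , (x≺v , λ z between → nothing-between (z , between)) , ≤-refl

  Path : Subset n → Fin n → Fin n → Set
  Path = HassePath P

  weaken : ∀ {A B x y} → A ⊆ B → Path A x y → Path B x y
  weaken A⊆B (here x∈A)     = here (A⊆B x∈A)
  weaken A⊆B (up x∈A c p)   = up (A⊆B x∈A) c (weaken A⊆B p)
  weaken A⊆B (down x∈A c p) = down (A⊆B x∈A) c (weaken A⊆B p)

  _++_ : ∀ {A x y z} → Path A x y → Path A y z → Path A x z
  here _       ++ q = q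
  up x∈A c p   ++ q = up x∈A c (p ++ q)
  down x∈A c p ++ q = down x∈A c (p ++ q)

  start∈ : ∀ {A x y} → Path A x y → x ∈ A
  start∈ (here x∈A)     = x∈A
  start∈ (up x∈A _ _)   = x∈A
  start∈ (down x∈A _ _) = x∈A

  reverse : ∀ {A x y} → Path A x y → Path A y x
  reverse (here x∈A)     = here x∈A
  reverse (up x∈A c p)   = reverse p ++ down (start∈ p) c (here x∈A)
  reverse (down x∈A c p) = reverse p ++ up (start∈ p) c (here x∈A)

  ∪-connected : ∀ {A B} → IsConnected P A → IsConnected P B → Nonempty (A ∩ B) →
                IsConnected P (A ∪ B)
  ∪-connected {A} {B} A-conn B-conn (c , c∈A∩B) x y x∈A∪B y∈A∪B =
    to-c x x∈A∪B ++ reverse (to-c y y∈A∪B)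
    where
    to-c : ∀ z → z ∈ A ∪ B → Path (A ∪ B) z c
    to-c z z∈A∪B with x∈p∪q⁻ A B z∈A∪B
    ... | inj₁ z∈A = weaken (p⊆p∪q B) (A-conn z c z∈A (proj₁ (x∈p∩q⁻ A B c∈A∩B)))
    ... | inj₂ z∈B = weaken (q⊆p∪q A B) (B-conn z c z∈B (proj₂ (x∈p∩q⁻ A B c∈A∩B)))

  -- Principal ideals are connected: every y ≤ j climbs to j along covers.
  ↓-connected : ∀ j → IsConnected P (↓ j)
  ↓-connected j x y x∈↓j y∈↓j =
    climb x (co-accessible x) (↓⁻ x∈↓j) ++ reverse (climb y (co-accessible y) (↓⁻ y∈↓j))
    where
    climb : ∀ x → Acc (λ a b → b ≺ a) x → x ≤ j → Path (↓ j) x j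
    climb x (acc rs) x≤j with x ≟ᶠ j
    ... | yes refl = here j∈↓j
    ... | no x≢j with cover-below (x≤j , x≢j)
    ...   | y , x⋖y , y≤j = up (↓⁺ x≤j) x⋖y (climb y (rs (proj₁ x⋖y)) y≤j)

  DownClosed : (Fin n → Set) → Set
  DownClosed Q = ∀ {x y} → y ≤ x → Q x → Q y

  record UpwardExit (K : Subset n) (Q : Fin n → Set) : Set where
    field
      lower upper : Fin n
      lower∈K     : lower ∈ K
      upper∈K     : upper ∈ K
      lower-in    : Q lower
      upper-out   : ¬ Q upper
      lower⋖upper : _⋖_ P lower upper

  upward-exit : ∀ {K Q x y} → (∀ z → Dec (Q z)) → DownClosed Q →
                Path K x y → Q x → ¬ Q y → UpwardExit K Q
  upward-exit Q? Q-down (here _) Qx ¬Qy = ⊥-elim (¬Qy Qx)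
  upward-exit Q? Q-down (up {y = w} x∈K x⋖w p) Qx ¬Qy with Q? w
  ... | yes Qw = upward-exit Q? Q-down p Qw ¬Qy
  ... | no ¬Qw = record
    { lower = _ ; upper = w ; lower∈K = x∈K ; upper∈K = start∈ p
    ; lower-in = Qx ; upper-out = ¬Qw ; lower⋖upper = x⋖w }
  upward-exit Q? Q-down (down x∈K w⋖x p) Qx ¬Qy =
    upward-exit Q? Q-down p (Q-down (proj₁ (proj₁ w⋖x)) Qx) ¬Qy

  ideal-down-closed : ∀ {I} → IsOrderIdeal P I → DownClosed (_∈ I)
  ideal-down-closed I-ideal y≤x x∈I = I-ideal _ _ y≤x x∈I

  ≤-down-closed : ∀ {j} → DownClosed (_≤ j)
  ≤-down-closed y≤x x≤j = ≤-trans y≤x x≤j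

module Splittings (P : FinPoset) (J : Subset (FinPoset.n P)) where
  open FinPoset P
  open PosetFacts P
  open IsPartialOrder isPartialOrder using ()
    renaming (refl to ≤-refl; trans to ≤-trans; antisym to ≤-antisym)

  Split : Subset n → Subset n → Set
  Split = IsSplitting P J

  Unique : Subset n → Subset n → Set
  Unique A B = ∀ K₁ K₂ → Split K₁ K₂ → ((K₁ ≡ A) × (K₂ ≡ B)) ⊎ ((K₁ ≡ B) × (K₂ ≡ A))

  split-union : ∀ {A B} → Split A B → A ∪ B ≡ J
  split-union (_ , _ , _ , _ , _ , _ , _ , A∪B≡J) = A∪B≡J

  swap-split : ∀ {A B} → Split A B → Split B A
  swap-split {A} {B} (A≠∅ , A-ideal , A-conn , B≠∅ , B-ideal , B-conn , ((c , c∈A∩B) , A⊈B , B⊈A) , A∪B≡J) =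
    B≠∅ , B-ideal , B-conn , A≠∅ , A-ideal , A-conn ,
    ((c , x∈p∩q⁺ (swap-× (x∈p∩q⁻ A B c∈A∩B))) , B⊈A , A⊈B) , trans (∪-comm B A) A∪B≡J

  swap-unique : ∀ {A B} → Unique A B → Unique B A
  swap-unique U K₁ K₂ S = swap-⊎ (U K₁ K₂ S)

  enlarge-right : ∀ {A B C} → Split A B → B ⊆ C → C ⊆ J → IsOrderIdeal P C → IsConnected P C →
                  ¬ (A ⊆ C) → Split A C
  enlarge-right {A} {B} {C} (A≠∅ , A-ideal , A-conn , (b , b∈B) , _ , _ , ((c , c∈A∩B) , _ , B⊈A) , A∪B≡J)
                B⊆C C⊆J C-ideal C-conn A⊈C =
    A≠∅ , A-ideal , A-conn , (b , B⊆C b∈B) , C-ideal , C-conn ,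
    ((c , x∈p∩q⁺ (c∈A , B⊆C c∈B)) , A⊈C , (λ C⊆A → B⊈A (λ x∈B → C⊆A (B⊆C x∈B)))) ,
    union-equals left⊆ C⊆J (λ x∈J → [ p⊆p∪q C , (λ x∈B → q⊆p∪q A C (B⊆C x∈B)) ]′ (either x∈J))
    where
    open UnionEquation A∪B≡J
    c∈A : c ∈ A
    c∈A = proj₁ (x∈p∩q⁻ A B c∈A∩B)
    c∈B : c ∈ B
    c∈B = proj₂ (x∈p∩q⁻ A B c∈A∩B)

  shrink-left : ∀ {A B C} → Split A B → C ⊆ A → A ⊆ C ∪ B → IsOrderIdeal P C → IsConnected P C →
                Nonempty (C ∩ B) → ¬ (C ⊆ B) → Split C B
  shrink-left {A} {B} {C} (_ , _ , _ , B≠∅ , B-ideal , B-conn , (_ , _ , B⊈A) , A∪B≡J)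
              C⊆A A⊆C∪B C-ideal C-conn (c , c∈C∩B) C⊈B =
    (c , proj₁ (x∈p∩q⁻ C B c∈C∩B)) , C-ideal , C-conn , B≠∅ , B-ideal , B-conn ,
    ((c , c∈C∩B) , C⊈B , (λ B⊆C → B⊈A (λ x∈B → C⊆A (B⊆C x∈B)))) ,
    union-equals (λ x∈C → left⊆ (C⊆A x∈C)) right⊆ (λ x∈J → [ A⊆C∪B , q⊆p∪q C B ]′ (either x∈J))
    where
    open UnionEquation A∪B≡J

  -- Growth lemma: in the unique splitting {A, B}, if x ∈ A ∖ B and ↓ x meets B,
  -- then A ⊆ ↓ x ∪ B; otherwise B ∪ ↓ x would be the second part of another splitting.
  grow : ∀ {A B x} → Split A B → Unique A B → x ∈ A → x ∉ B → Nonempty (↓ x ∩ B) → A ⊆ ↓ x ∪ B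
  grow {A} {B} {x} S@(_ , A-ideal , _ , _ , B-ideal , B-conn , (_ , A⊈B , _) , A∪B≡J) U x∈A x∉B meet =
    decidable-stable (A ⊆? ↓ x ∪ B) no-counterexample
    where
    open UnionEquation A∪B≡J
    ↓x∪B⊆J : ↓ x ∪ B ⊆ J
    ↓x∪B⊆J = ∪-⊆ (λ y∈↓x → left⊆ (↓-least A-ideal x∈A y∈↓x)) right⊆
    no-counterexample : ¬ ¬ (A ⊆ ↓ x ∪ B)
    no-counterexample A⊈↓x∪B
      with U A (↓ x ∪ B) (enlarge-right S (q⊆p∪q (↓ x) B) ↓x∪B⊆J (∪-ideal (↓-ideal x) B-ideal)
                                        (∪-connected (↓-connected x) B-conn meet) A⊈↓x∪B)
    ... | inj₁ (_ , ↓x∪B≡B) = x∉B (subst (x ∈_) ↓x∪B≡B (p⊆p∪q B j∈↓j))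
    ... | inj₂ (A≡B , _)    = A⊈B (⊆-reflexive A≡B)

  principal-part : ∀ {A B} → Split A B → Unique A B → ∃[ x ] (A ≡ ↓ x × x ∉ B × IsMaximalIn P J x)
  principal-part {A} {B} S@(_ , A-ideal , A-conn , _ , B-ideal , _ , ((c , c∈A∩B) , A⊈B , _) , A∪B≡J) U
    with witness-outside A⊈B
  ... | w , w∈A , w∉B = x , A≡↓x , x∉B , x-maximal
    where
    open UnionEquation A∪B≡J
    -- a path in A from c ∈ B to w ∉ B leaves B along a cover lower ⋖ upper
    open UpwardExit (upward-exit (_∈? B) (ideal-down-closed B-ideal)
                       (A-conn c w (proj₁ (x∈p∩q⁻ A B c∈A∩B)) w∈A) (proj₂ (x∈p∩q⁻ A B c∈A∩B)) w∉B)
    open MaximalAbove (maximal-above (left⊆ upper∈K)) renaming (top to x; top-maximal to x-maximal)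
    x∉B : x ∉ B
    x∉B x∈B = upper-out (B-ideal x upper below-top x∈B)
    x∈A : x ∈ A
    x∈A = [ (λ x∈A → x∈A) , (λ x∈B → ⊥-elim (x∉B x∈B)) ]′ (either (proj₁ x-maximal))
    meet : Nonempty (↓ x ∩ B)
    meet = lower , x∈p∩q⁺ (↓⁺ (≤-trans (proj₁ (proj₁ lower⋖upper)) below-top) , lower-in)
    smaller : Split (↓ x) B
    smaller = shrink-left S (↓-least A-ideal x∈A) (grow S U x∈A x∉B meet) (↓-ideal x) (↓-connected x)
                          meet (λ ↓x⊆B → x∉B (↓x⊆B j∈↓j))
    A≡↓x : A ≡ ↓ x
    A≡↓x = [ (λ (↓x≡A , _) → sym ↓x≡A) , (λ (↓x≡B , _) → ⊥-elim (x∉B (subst (x ∈_) ↓x≡B j∈↓j))) ]′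
             (U (↓ x) B smaller)

  -- In the unique splitting {↓ a, ↓ b} with a ∉ ↓ b, a point p strictly between
  -- some ℓ ≤ b and a is also strictly below b (apply the growth lemma to p).
  interval-transfer : ∀ {a b ℓ p} → Split (↓ a) (↓ b) → Unique (↓ a) (↓ b) → IsMaximalIn P J b →
                      a ∉ ↓ b → ℓ ≤ b → OpenInterval P ℓ a p → OpenInterval P ℓ b p
  interval-transfer {a} {b} {ℓ} {p} S U b-maximal a∉↓b ℓ≤b (ℓ≺p , p≺a) = ℓ≺p , p≤b , p≢b
    where
    p≢b : p ≢ b
    p≢b p≡b = proj₂ b-maximal a (UnionEquation.left⊆ (split-union S) j∈↓j) (subst (_≺ a) p≡b p≺a)
    a∉↓p : a ∉ ↓ p
    a∉↓p a∈↓p = proj₂ p≺a (≤-antisym (proj₁ p≺a) (↓⁻ a∈↓p))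
    p≤b : p ≤ b
    p≤b = decidable-stable (p ≤? b) λ p≰b →
      [ a∉↓p , a∉↓b ]′ (x∈p∪q⁻ (↓ p) (↓ b)
        (grow S U (↓⁺ (proj₁ p≺a)) (λ p∈↓b → p≰b (↓⁻ p∈↓b))
              (ℓ , x∈p∩q⁺ (↓⁺ (proj₁ ℓ≺p) , ↓⁺ ℓ≤b)) j∈↓j))

  TwoTops : Fin n → Fin n → Set
  TwoTops j₁ j₂ = j₁ ≢ j₂ × IsMaximalIn P J j₁ × IsMaximalIn P J j₂ ×
    (∀ x → IsMaximalIn P J x → (x ≡ j₁) ⊎ (x ≡ j₂)) ×
    (∀ ℓ → ℓ ≺ j₁ → ℓ ≺ j₂ → ∀ p → OpenInterval P ℓ j₁ p ⇔ OpenInterval P ℓ j₂ p)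

  unique-split-tops : ∀ {A B a b} → Split A B → Unique A B → A ≡ ↓ a → B ≡ ↓ b → a ∉ B → b ∉ A →
                      IsMaximalIn P J a → IsMaximalIn P J b → TwoTops a b
  unique-split-tops {a = a} {b} S U refl refl a∉↓b b∉↓a a-maximal b-maximal =
    a≢b , a-maximal , b-maximal , only-tops , intervals
    where
    open UnionEquation (split-union S)
    a≢b : a ≢ b
    a≢b a≡b = a∉↓b (subst (_∈ ↓ b) (sym a≡b) j∈↓j)
    only-tops : ∀ x → IsMaximalIn P J x → (x ≡ a) ⊎ (x ≡ b)
    only-tops x x-maximal =
      map-⊎ (λ x∈↓a → maximal-≤ x-maximal (proj₁ a-maximal) (↓⁻ x∈↓a))
            (λ x∈↓b → maximal-≤ x-maximal (proj₁ b-maximal) (↓⁻ x∈↓b))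
            (either (proj₁ x-maximal))
    intervals : ∀ ℓ → ℓ ≺ a → ℓ ≺ b → ∀ p → OpenInterval P ℓ a p ⇔ OpenInterval P ℓ b p
    intervals ℓ ℓ≺a ℓ≺b p =
      mk⇔ (interval-transfer S U b-maximal a∉↓b (proj₁ ℓ≺b))
          (interval-transfer (swap-split S) (swap-unique U) a-maximal b∉↓a (proj₁ ℓ≺a))

  -- Nearly principal ⇒ (a) and (b): both parts of the unique splitting are principal.
  forward : IsNearlyPrincipal P J → ∃[ a ] ∃[ b ] TwoTops a b
  forward (_ , _ , _ , A , B , S , U) =
    let (a , A≡↓a , a∉B , a-maximal) = principal-part S U
        (b , B≡↓b , b∉A , b-maximal) = principal-part (swap-split S) (swap-unique U)
    in a , b , unique-split-tops S U A≡↓a B≡↓b a∉B b∉A a-maximal b-maximal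

  swap-tops : ∀ {a b} → TwoTops a b → TwoTops b a
  swap-tops (a≢b , a-maximal , b-maximal , only-tops , intervals) =
    (λ b≡a → a≢b (sym b≡a)) , b-maximal , a-maximal ,
    (λ x x-maximal → swap-⊎ (only-tops x x-maximal)) ,
    (λ ℓ ℓ≺b ℓ≺a p → ⇔-sym (intervals ℓ ℓ≺a ℓ≺b p))

  below-tops : ∀ {a b x} → TwoTops a b → x ∈ J → x ≤ a ⊎ x ≤ b
  below-tops {x = x} (_ , _ , _ , only-tops , _) x∈J =
    map-⊎ (λ top≡a → subst (x ≤_) top≡a below-top) (λ top≡b → subst (x ≤_) top≡b below-top)
          (only-tops top top-maximal)
    where open MaximalAbove (maximal-above x∈J)

  -- Under (a) and (b), a connected ideal K ⊆ J containing a but not b is ↓ a: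
  -- leaving ↓ a inside K along a cover u ⋖ v would give v ∈ ]u, b[ = ]u, a[.
  principal-at-top : ∀ {a b K} → TwoTops a b → IsOrderIdeal P K → IsConnected P K → K ⊆ J →
                     a ∈ K → b ∉ K → K ≡ ↓ a
  principal-at-top {a} {b} {K} T@(_ , a-maximal , _ , _ , intervals) K-ideal K-conn K⊆J a∈K b∉K =
    ⊆-antisym K⊆↓a (↓-least K-ideal a∈K)
    where
    no-exit : ¬ UpwardExit K (_≤ a)
    no-exit e = upper-out ([ (λ upper≤a → upper≤a) , through-b ]′ (below-tops T (K⊆J upper∈K)))
      where
      open UpwardExit e
      lower≺upper : lower ≺ upper
      lower≺upper = proj₁ lower⋖upper
      lower≺a : lower ≺ a
      lower≺a = lower-in , λ lower≡a →
        proj₂ a-maximal upper (K⊆J upper∈K) (subst (_≺ upper) lower≡a lower≺upper)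
      through-b : upper ≤ b → upper ≤ a
      through-b upper≤b =
        proj₁ (proj₂ (Equivalence.from (intervals lower lower≺a lower≺b upper) (lower≺upper , upper≺b)))
        where
        upper≺b : upper ≺ b
        upper≺b = upper≤b , λ upper≡b → b∉K (subst (_∈ K) upper≡b upper∈K)
        lower≺b : lower ≺ b
        lower≺b = ≤-trans (proj₁ lower≺upper) upper≤b , λ lower≡b → b∉K (subst (_∈ K) lower≡b lower∈K)
    K⊆↓a : K ⊆ ↓ a
    K⊆↓a {z} z∈K = ↓⁺ (decidable-stable (z ≤? a) λ z≰a →
      no-exit (upward-exit (_≤? a) ≤-down-closed (K-conn a z a∈K z∈K) ≤-refl z≰a))

  tops-splitting : ∀ {a b K₁ K₂} → TwoTops a b → Split K₁ K₂ → a ∈ K₁ → (K₁ ≡ ↓ a) × (K₂ ≡ ↓ b)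
  tops-splitting {a} {b} {K₁} {K₂} T@(_ , _ , b-maximal , _ , _)
                 (_ , K₁-ideal , K₁-conn , _ , K₂-ideal , K₂-conn , (_ , K₁⊈K₂ , K₂⊈K₁) , K₁∪K₂≡J) a∈K₁ =
    K₁≡↓a , K₂≡↓b
    where
    open UnionEquation K₁∪K₂≡J
    b∉K₁ : b ∉ K₁
    b∉K₁ b∈K₁ = K₂⊈K₁ λ x∈K₂ →
      [ (λ x≤a → K₁-ideal a _ x≤a a∈K₁) , (λ x≤b → K₁-ideal b _ x≤b b∈K₁) ]′ (below-tops T (right⊆ x∈K₂))
    K₁≡↓a : K₁ ≡ ↓ a
    K₁≡↓a = principal-at-top T K₁-ideal K₁-conn left⊆ a∈K₁ b∉K₁
    b∈K₂ : b ∈ K₂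
    b∈K₂ = [ (λ b∈K₁ → ⊥-elim (b∉K₁ b∈K₁)) , (λ b∈K₂ → b∈K₂) ]′ (either (proj₁ b-maximal))
    a∉K₂ : a ∉ K₂
    a∉K₂ a∈K₂ = K₁⊈K₂ λ x∈K₁ → ↓-least K₂-ideal a∈K₂ (subst (_ ∈_) K₁≡↓a x∈K₁)
    K₂≡↓b : K₂ ≡ ↓ b
    K₂≡↓b = principal-at-top (swap-tops T) K₂-ideal K₂-conn right⊆ b∈K₂ a∉K₂

  tops-split : ∀ {a b} → IsOrderIdeal P J → IsConnected P J → TwoTops a b → Split (↓ a) (↓ b)
  tops-split {a} {b} J-ideal J-conn T@(a≢b , a-maximal , b-maximal , _ , _) =
    (a , j∈↓j) , ↓-ideal a , ↓-connected a , (b , j∈↓j) , ↓-ideal b , ↓-connected b ,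
    (meet , (λ ↓a⊆↓b → a≰b (↓⁻ (↓a⊆↓b j∈↓j))) , (λ ↓b⊆↓a → b≰a (↓⁻ (↓b⊆↓a j∈↓j)))) ,
    union-equals (↓-least J-ideal a∈J) (↓-least J-ideal b∈J)
                 (λ x∈J → x∈p∪q⁺ (map-⊎ ↓⁺ ↓⁺ (below-tops T x∈J)))
    where
    a∈J : a ∈ J
    a∈J = proj₁ a-maximal
    b∈J : b ∈ J
    b∈J = proj₁ b-maximal
    a≰b : ¬ (a ≤ b)
    a≰b = maximal-≰ a-maximal b∈J a≢b
    b≰a : ¬ (b ≤ a)
    b≰a = maximal-≰ b-maximal a∈J (λ b≡a → a≢b (sym b≡a))
    -- a path in J from a to b leaves ↓ a along a cover u ⋖ v with v ≤ b
    meet : Nonempty (↓ a ∩ ↓ b)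
    meet = lower , x∈p∩q⁺ (↓⁺ lower-in , ↓⁺ (≤-trans (proj₁ (proj₁ lower⋖upper)) upper≤b))
      where
      open UpwardExit (upward-exit (_≤? a) ≤-down-closed (J-conn a b a∈J b∈J) ≤-refl b≰a)
      upper≤b : upper ≤ b
      upper≤b = [ (λ upper≤a → ⊥-elim (upper-out upper≤a)) , (λ upper≤b → upper≤b) ]′
                  (below-tops T upper∈K)

  tops-unique : ∀ {a b} → TwoTops a b → Unique (↓ a) (↓ b)
  tops-unique T@(_ , a-maximal , _ , _ , _) K₁ K₂ S
    with UnionEquation.either (split-union S) (proj₁ a-maximal)
  ... | inj₁ a∈K₁ = inj₁ (tops-splitting T S a∈K₁)
  ... | inj₂ a∈K₂ = inj₂ (swap-× (tops-splitting T (swap-split S) a∈K₂))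

  backward : IsOrderIdeal P J → IsConnected P J → ¬ IsPrincipal P J →
             ∃[ a ] ∃[ b ] TwoTops a b → IsNearlyPrincipal P J
  backward J-ideal J-conn J-nonprincipal (a , b , T) =
    J-ideal , J-conn , J-nonprincipal , ↓ a , ↓ b , tops-split J-ideal J-conn T , tops-unique T

proposition10p4 : (P : FinPoset) (J : Subset (FinPoset.n P)) →
    IsOrderIdeal P J → IsConnected P J → ¬ IsPrincipal P J →
    IsNearlyPrincipal P J ⇔
      (∃[ j₁ ] ∃[ j₂ ] (j₁ ≢ j₂ × IsMaximalIn P J j₁ × IsMaximalIn P J j₂ ×
        (∀ x → IsMaximalIn P J x → (x ≡ j₁) ⊎ (x ≡ j₂)) ×
        (∀ ℓ → _<_ P ℓ j₁ → _<_ P ℓ j₂ →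
          ∀ p → OpenInterval P ℓ j₁ p ⇔ OpenInterval P ℓ j₂ p)))
proposition10p4 P J J-ideal J-conn J-nonprincipal =
  mk⇔ forward (backward J-ideal J-conn J-nonprincipal)
  where open Splittings P J
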